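{- Let $s\ge1$ and let $\mathrm{rank}:\mathcal{R}\to\{0,\ldots,s\}$. The relation $\preceq$ on $\Delta$ is a partial order (reflexive, transitive and anti-symmetric).
   Context: $\mathcal{U}$ is a non-empty finite set, $(\mathcal{L},\sqsubseteq)$ a complete lattice, and $\mathcal{R}$ a finite set of predicate symbols each with an arity $k\ge0$. $\Delta$ is the set of all maps $\varrho$ assigning to each $R\in\mathcal{R}$ of arity $k$ a function $\varrho(R):\mathcal{U}^k\to\mathcal{L}$. Write $\varrho_1(R)\sqsubseteq\varrho_2(R)$ iff $\varrho_1(R)(\vec a)\sqsubseteq\varrho_2(R)(\vec a)$ for all $\vec a\in\mathcal{U}^k$, and $\varrho_1(R)\sqsubset\varrho_2(R)$ iff $\varrho_1(R)\sqsubseteq\varrho_2(R)$ and $\varrho_1(R)\ne\varrho_2(R)$. Define $\varrho_1\preceq\varrho_2$ iff there is some $1\le j\le s$ such that: (a) $\varrho_1(R)=\varrho_2(R)$ for all $R$ with $\mathrm{rank}(R)<j$; (b) $\varrho_1(R)\sqsubseteq\varrho_2(R)$ for all $R$ with $\mathrm{rank}(R)=j$; (c) either $j=s$ or $\varrho_1(R)\sqsubset\varrho_2(R)$ for at least one $R$ with $\mathrm{rank}(R)=j$. (In the paper, $s$ is the number of clauses of a stratified LLFP clause sequence $cl_1,\ldots,cl_s$ and $\mathrm{rank}$ its stratification function.) -}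

module Defs where

open import Level using (Level; _⊔_; suc)
open import Data.Nat using (ℕ; _<_; _≤_)
open import Data.Fin using (Fin)
open import Data.Vec using (Vec)
open import Data.Product using (Σ; _×_)
open import Data.Sum using (_⊎_)
open import Relation.Nullary using (¬_)
open import Relation.Unary using (Pred; _∈_)
open import Relation.Binary.Bundles using (Poset)
open import Relation.Binary.PropositionalEquality using (_≡_)

record CompleteLattice (c ℓ₁ ℓ₂ : Level) : Set (Level.suc (c ⊔ ℓ₁ ⊔ ℓ₂)) where
  field
    poset : Poset c ℓ₁ ℓ₂
  open Poset poset public renaming (_≤_ to _⊑_)
  field
    ⨆       : Pred Carrier c → Carrier
    ⨆-upper : ∀ (S : Pred Carrier c) x → x ∈ S → x ⊑ ⨆ S
    ⨆-least : ∀ (S : Pred Carrier c) y → (∀ x → x ∈ S → x ⊑ y) → ⨆ S ⊑ y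
    ⨅       : Pred Carrier c → Carrier
    ⨅-lower : ∀ (S : Pred Carrier c) x → x ∈ S → ⨅ S ⊑ x
    ⨅-great : ∀ (S : Pred Carrier c) y → (∀ x → x ∈ S → y ⊑ x) → y ⊑ ⨅ S

-- U = Fin (suc n) (a non-empty finite set), predicate symbols R = Fin m,
-- with arities  arity : Fin m → ℕ.
module Interpretations {c ℓ₁ ℓ₂ : Level} (L : CompleteLattice c ℓ₁ ℓ₂)
                       (n m : ℕ) (arity : Fin m → ℕ) where
  open CompleteLattice L renaming (_≈_ to _≈L_)

  U : Set
  U = Fin (Data.Nat.suc n)

  Δ : Set c
  Δ = (R : Fin m) → Vec U (arity R) → Carrier

  _≈R_ : {R : Fin m} → (Vec U (arity R) → Carrier) → (Vec U (arity R) → Carrier) → Set ℓ₁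
  f ≈R g = ∀ a → f a ≈L g a

  _⊑R_ : {R : Fin m} → (Vec U (arity R) → Carrier) → (Vec U (arity R) → Carrier) → Set ℓ₂
  f ⊑R g = ∀ a → f a ⊑ g a

  _⊏R_ : {R : Fin m} → (Vec U (arity R) → Carrier) → (Vec U (arity R) → Carrier) → Set (ℓ₁ ⊔ ℓ₂)
  f ⊏R g = (f ⊑R g) × ¬ (f ≈R g)

  _≈Δ_ : Δ → Δ → Set ℓ₁
  ϱ₁ ≈Δ ϱ₂ = ∀ R → ϱ₁ R ≈R ϱ₂ R

  module Order (s : ℕ) (rank : Fin m → ℕ) where
    _≼_ : Δ → Δ → Set (ℓ₁ ⊔ ℓ₂)
    ϱ₁ ≼ ϱ₂ = Σ ℕ λ j → (1 ≤ j) × (j ≤ s)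
      × (∀ R → rank R < j → ϱ₁ R ≈R ϱ₂ R)
      × (∀ R → rank R ≡ j → ϱ₁ R ⊑R ϱ₂ R)
      × ((j ≡ s) ⊎ Σ (Fin m) λ R → (rank R ≡ j) × (ϱ₁ R ⊏R ϱ₂ R))

module Submission where

-- Two witnesses at levels j < j′ compose at the
-- lower level j, where the strict increase survives because the interpretations agree
-- at j; at equal levels everything composes pointwise.  For antisymmetry, levels j < j′
-- would make some ϱ(R) strictly below itself, and at a common level j the strict
-- increase is impossible, so j = s and, as every rank is at most s, the two agree.

open import Defs
open import Level using (Level; _⊔_)
open import Data.Nat using (ℕ; _≤_; _<_)
open import Data.Nat.Properties using (<-cmp; <-trans; <-≤-trans; ≤-refl; <⇒≢; m≤n⇒m<n∨m≡n)
open import Data.Fin using (Fin)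
open import Data.Vec using (Vec)
open import Data.Product using (Σ; _×_; _,_)
open import Data.Sum using (_⊎_; inj₁; inj₂; map₂)
open import Relation.Nullary using (¬_; contradiction)
open import Relation.Binary using (tri<; tri≈; tri>)
open import Relation.Binary.Bundles using (Poset)
open import Relation.Binary.Structures using (IsPartialOrder; IsEquivalence)
open import Relation.Binary.Definitions using (Transitive; Antisymmetric)
open import Relation.Binary.PropositionalEquality using (_≡_; refl; sym; subst)
import Relation.Binary.Construct.NonStrictToStrict as NonStrictToStrict
import Relation.Binary.Properties.Poset as PosetProperties

pointwise-poset : ∀ {a c ℓ₁ ℓ₂} → Set a → Poset c ℓ₁ ℓ₂ → Poset (a ⊔ c) (a ⊔ ℓ₁) (a ⊔ ℓ₂)
pointwise-poset A P = record
  { Carrier        = A → P.Carrier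
  ; _≈_            = λ f g → ∀ x → f x P.≈ g x
  ; _≤_            = λ f g → ∀ x → f x P.≤ g x
  ; isPartialOrder = record
    { isPreorder = record
      { isEquivalence = record
        { refl  = λ _ → P.Eq.refl
        ; sym   = λ f≈g x → P.Eq.sym (f≈g x)
        ; trans = λ f≈g g≈h x → P.Eq.trans (f≈g x) (g≈h x)
        }
      ; reflexive = λ f≈g x → P.reflexive (f≈g x)
      ; trans     = λ f≤g g≤h x → P.trans (f≤g x) (g≤h x)
      }
    ; antisym = λ f≤g g≤f x → P.antisym (f≤g x) (g≤f x)
    }
  }
  where module P = Poset P

module StratifiedOrder {c ℓ₁ ℓ₂ : Level} (L : CompleteLattice c ℓ₁ ℓ₂)
                       (n m : ℕ) (arity : Fin m → ℕ) where
  open CompleteLattice L using (poset)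
  open Interpretations L n m arity

  -- The strict order induced by this poset is definitionally _⊏R_.
  module Pointwise (R : Fin m) where
    private
      P = pointwise-poset (Vec U (arity R)) poset
    open Poset P public using (module Eq; reflexive; trans; antisym; ≤-respˡ-≈; ≤-respʳ-≈)
    open PosetProperties P public using (<-respˡ-≈; <-respʳ-≈)

    ⊏-⊑-trans : ∀ {f g h} → _⊏R_ {R} f g → _⊑R_ {R} g h → _⊏R_ {R} f h
    ⊏-⊑-trans = NonStrictToStrict.<-≤-trans (_≈R_ {R}) (_⊑R_ {R}) Eq.sym trans antisym ≤-respʳ-≈

  ≈Δ-isEquivalence : IsEquivalence _≈Δ_
  ≈Δ-isEquivalence = record
    { refl  = λ R → Pointwise.Eq.refl R
    ; sym   = λ x≈y R → Pointwise.Eq.sym R (x≈y R)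
    ; trans = λ x≈y y≈z R → Pointwise.Eq.trans R (x≈y R) (y≈z R)
    }

  module _ (s : ℕ) (rank : Fin m → ℕ) where
    open Order s rank

    EqualBelow : ℕ → Δ → Δ → Set ℓ₁
    EqualBelow j ϱ₁ ϱ₂ = ∀ R → rank R < j → ϱ₁ R ≈R ϱ₂ R

    StrictAt : ℕ → Δ → Δ → Set (ℓ₁ ⊔ ℓ₂)
    StrictAt j ϱ₁ ϱ₂ = Σ (Fin m) λ R → (rank R ≡ j) × (_⊏R_ {R} (ϱ₁ R) (ϱ₂ R))

    EqualBelow-at : ∀ {j j′ ϱ₁ ϱ₂ R} → EqualBelow j′ ϱ₁ ϱ₂ → rank R ≡ j → j < j′ →
                    ϱ₁ R ≈R ϱ₂ R
    EqualBelow-at {j′ = j′} {R = R} eq r j<j′ = eq R (subst (_< j′) (sym r) j<j′)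

    strictAt-below-top : ∀ {j ϱ₁ ϱ₂} → j < s → (j ≡ s) ⊎ StrictAt j ϱ₁ ϱ₂ → StrictAt j ϱ₁ ϱ₂
    strictAt-below-top j<s (inj₁ j≡s) = contradiction j≡s (<⇒≢ j<s)
    strictAt-below-top _   (inj₂ st)  = st

    StrictAt-irrefl : ∀ {j ϱ} → ¬ StrictAt j ϱ ϱ
    StrictAt-irrefl (R , _ , _ , ϱ≉ϱ) = ϱ≉ϱ (Pointwise.Eq.refl R)

    StrictAt-respʳ : ∀ {j j′ ϱ₁ ϱ₂ ϱ₃} → j < j′ →
                     StrictAt j ϱ₁ ϱ₂ → EqualBelow j′ ϱ₂ ϱ₃ → StrictAt j ϱ₁ ϱ₃
    StrictAt-respʳ j<j′ (R , r , ϱ₁⊏ϱ₂) eq =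
      R , r , Pointwise.<-respʳ-≈ R (EqualBelow-at eq r j<j′) ϱ₁⊏ϱ₂

    StrictAt-respˡ : ∀ {j j′ ϱ₁ ϱ₂ ϱ₃} → j < j′ →
                     EqualBelow j′ ϱ₁ ϱ₂ → StrictAt j ϱ₂ ϱ₃ → StrictAt j ϱ₁ ϱ₃
    StrictAt-respˡ j<j′ eq (R , r , ϱ₂⊏ϱ₃) =
      R , r , Pointwise.<-respˡ-≈ R (Pointwise.Eq.sym R (EqualBelow-at eq r j<j′)) ϱ₂⊏ϱ₃

    StrictAt-⊑-trans : ∀ {j ϱ₁ ϱ₂ ϱ₃} → StrictAt j ϱ₁ ϱ₂ →
                       (∀ R → rank R ≡ j → ϱ₂ R ⊑R ϱ₃ R) → StrictAt j ϱ₁ ϱ₃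
    StrictAt-⊑-trans (R , r , ϱ₁⊏ϱ₂) le = R , r , Pointwise.⊏-⊑-trans R ϱ₁⊏ϱ₂ (le R r)

    ≼-reflexive : 1 ≤ s → ∀ {ϱ₁ ϱ₂} → ϱ₁ ≈Δ ϱ₂ → ϱ₁ ≼ ϱ₂
    ≼-reflexive 1≤s ϱ₁≈ϱ₂ =
      s , 1≤s , ≤-refl , (λ R _ → ϱ₁≈ϱ₂ R) , (λ R _ → Pointwise.reflexive R (ϱ₁≈ϱ₂ R)) , inj₁ refl

    ≼-trans : Transitive _≼_
    ≼-trans (j₁ , 1≤j₁ , j₁≤s , eq₁ , le₁ , st₁) (j₂ , 1≤j₂ , j₂≤s , eq₂ , le₂ , st₂)
      with <-cmp j₁ j₂
    ... | tri< j₁<j₂ _ _ =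
      j₁ , 1≤j₁ , j₁≤s
      , (λ R r → Pointwise.Eq.trans R (eq₁ R r) (eq₂ R (<-trans r j₁<j₂)))
      , (λ R r → Pointwise.≤-respʳ-≈ R (EqualBelow-at eq₂ r j₁<j₂) (le₁ R r))
      , inj₂ (StrictAt-respʳ j₁<j₂ (strictAt-below-top (<-≤-trans j₁<j₂ j₂≤s) st₁) eq₂)
    ... | tri≈ _ refl _ =
      j₁ , 1≤j₁ , j₁≤s
      , (λ R r → Pointwise.Eq.trans R (eq₁ R r) (eq₂ R r))
      , (λ R r → Pointwise.trans R (le₁ R r) (le₂ R r))
      , map₂ (λ st → StrictAt-⊑-trans st le₂) st₁
    ... | tri> _ _ j₂<j₁ =
      j₂ , 1≤j₂ , j₂≤s
      , (λ R r → Pointwise.Eq.trans R (eq₁ R (<-trans r j₂<j₁)) (eq₂ R r))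
      , (λ R r → Pointwise.≤-respˡ-≈ R (Pointwise.Eq.sym R (EqualBelow-at eq₁ r j₂<j₁)) (le₂ R r))
      , inj₂ (StrictAt-respˡ j₂<j₁ eq₁ (strictAt-below-top (<-≤-trans j₂<j₁ j₁≤s) st₂))

    ≼-antisym : (∀ R → rank R ≤ s) → Antisymmetric _≈Δ_ _≼_
    ≼-antisym rank≤s {ϱ₁} {ϱ₂} (j₁ , _ , j₁≤s , eq₁ , le₁ , st₁) (j₂ , _ , j₂≤s , eq₂ , le₂ , st₂)
      with <-cmp j₁ j₂
    ... | tri< j₁<j₂ _ _ =
      contradiction (StrictAt-respʳ j₁<j₂ (strictAt-below-top (<-≤-trans j₁<j₂ j₂≤s) st₁) eq₂)
                    StrictAt-irrefl
    ... | tri> _ _ j₂<j₁ =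
      contradiction (StrictAt-respʳ j₂<j₁ (strictAt-below-top (<-≤-trans j₂<j₁ j₁≤s) st₂) eq₁)
                    StrictAt-irrefl
    ... | tri≈ _ refl _ with st₁
    ...   | inj₂ st    = contradiction (StrictAt-⊑-trans st le₂) StrictAt-irrefl
    ...   | inj₁ refl  = λ R → agree R (m≤n⇒m<n∨m≡n (rank≤s R))
      where
      agree : ∀ R → rank R < s ⊎ rank R ≡ s → ϱ₁ R ≈R ϱ₂ R
      agree R (inj₁ r<s) = eq₁ R r<s
      agree R (inj₂ r≡s) = Pointwise.antisym R (le₁ R r≡s) (le₂ R r≡s)

    ≼-isPartialOrder : 1 ≤ s → (∀ R → rank R ≤ s) → IsPartialOrder _≈Δ_ _≼_
    ≼-isPartialOrder 1≤s rank≤s = record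
      { isPreorder = record
        { isEquivalence = ≈Δ-isEquivalence
        ; reflexive     = ≼-reflexive 1≤s
        ; trans         = ≼-trans
        }
      ; antisym = ≼-antisym rank≤s
      }

lemma1 : ∀ {c ℓ₁ ℓ₂ : Level} (L : CompleteLattice c ℓ₁ ℓ₂)
         (n m : ℕ) (arity : Fin m → ℕ) (s : ℕ) → 1 ≤ s →
         (rank : Fin m → ℕ) → (∀ R → rank R ≤ s) →
         IsPartialOrder (Interpretations._≈Δ_ L n m arity)
                        (Interpretations.Order._≼_ L n m arity s rank)
lemma1 L n m arity s 1≤s rank rank≤s =
  StratifiedOrder.≼-isPartialOrder L n m arity s rank 1≤s rank≤s
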